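{- The action of $D_4$ on $sh_{\mathtt{XXY}}$ is free.
   Context: Let $\mathcal{B}=\{\mathtt{A},\mathtt{C},\mathtt{G},\mathtt{T}\}$ be the genetic alphabet, and let $c\colon\mathcal{B}\to\mathcal{B}$ be the complementarity map $c(\mathtt{A})=\mathtt{T}$, $c(\mathtt{T})=\mathtt{A}$, $c(\mathtt{C})=\mathtt{G}$, $c(\mathtt{G})=\mathtt{C}$. For a codon $w=N_1N_2N_3\in\mathcal{B}^3$ its reverse complement is $\overleftarrow{c}(w)=c(N_3)c(N_2)c(N_1)$, and $\alpha(N_1N_2N_3)=N_3N_1N_2$ is the cyclic shift. A set of 3-letter words is a circular code if any concatenation of its words written on a circle can be decomposed into a concatenation of its words in a unique way. "Circular code" means a maximal $C^3$ circular code: a circular code $\mathcal{C}$ with $|\mathcal{C}|=20$, $\overleftarrow{c}(\mathcal{C})=\mathcal{C}$, and $\alpha(\mathcal{C})$ (hence also $\alpha^2(\mathcal{C})$) circular. A codon has shape $\mathtt{XXY}$ if it is of the form $NNM$ with $N\neq M$; $sh(\mathcal{C},\mathtt{XXY})$ is the set of codons of $\mathcal{C}$ of this shape, and $sh_{\mathtt{XXY}}=\{sh(\mathcal{C},\mathtt{XXY})\mid \mathcal{C}\text{ a circular code}\}$. The dihedral group $D_4$ acts letter-wise on $\mathcal{B}^3$ via its action by symmetries of a square whose vertices are labeled by the bases with $\mathtt{A},\mathtt{T}$ opposite and $\mathtt{C},\mathtt{G}$ opposite (central reflection $c$, axis reflections $p$: $\mathtt{A}\leftrightarrow\mathtt{G}$,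 $\mathtt{C}\leftrightarrow\mathtt{T}$ and $r$: $\mathtt{A}\leftrightarrow\mathtt{C}$, $\mathtt{G}\leftrightarrow\mathtt{T}$); this preserves shapes and so induces an action on $sh_{\mathtt{XXY}}$. -}

module Defs where

open import Data.Bool using (Bool; true; false; _∧_; not)
open import Data.List using (List; []; _∷_; _++_; length; filter; concatMap; map)
open import Data.List.Relation.Unary.All using (All)
open import Data.Nat using (ℕ)
open import Data.Product using (Σ; _×_; _,_)
open import Relation.Binary.PropositionalEquality using (_≡_; _≢_)
open import Relation.Nullary using (¬_)
open import Function using (_∘_)

data Base : Set where
  A C G T : Base

allBases : List Base
allBases = A ∷ C ∷ G ∷ T ∷ []

eqB : Base → Base → Bool
eqB A A = true
eqB C C = true
eqB G G = true
eqB T T = true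
eqB _ _ = false

comp : Base → Base
comp A = T
comp T = A
comp C = G
comp G = C

record Codon : Set where
  constructor cod
  field
    n₁ n₂ n₃ : Base
open Codon public

allCodons : List Codon
allCodons = concatMap (λ a → concatMap (λ b → map (cod a b) allBases) allBases) allBases

word : Codon → List Base
word (cod a b c) = a ∷ b ∷ c ∷ []

flat : List Codon → List Base
flat [] = []
flat (x ∷ xs) = word x ++ flat xs

revComp : Codon → Codon
revComp (cod a b c) = cod (comp c) (comp b) (comp a)

shift : Codon → Codon
shift (cod a b c) = cod c a b

CodonSet : Set
CodonSet = Codon → Bool

_∈ₛ_ : Codon → CodonSet → Set
w ∈ₛ X = X w ≡ true

card : CodonSet → ℕ
card X = length (filter (λ w → X w ≡? true) allCodons)
  where
  open import Data.Bool.Properties renaming (_≟_ to _≡?_)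

-- image of a set under an invertible map, given via the inverse map:
-- w ∈ f(X)  iff  f⁻¹ w ∈ X
-- α(X): w ∈ α(X) iff α⁻¹(w) = α²(w) ∈ X
shiftSet : CodonSet → CodonSet
shiftSet X w = X (shift (shift w))

IsCircular : CodonSet → Set
IsCircular X =
  (x₁ : Codon) (xs ys : List Codon) (p s : List Base) →
  x₁ ∈ₛ X → All (_∈ₛ X) xs → All (_∈ₛ X) ys →
  s ≢ [] →
  word x₁ ≡ p ++ s →
  s ++ flat xs ++ p ≡ flat ys →
  (length (x₁ ∷ xs) ≡ length ys) × (p ≡ []) × (x₁ ∷ xs ≡ ys)

IsMaxC3Code : CodonSet → Set
IsMaxC3Code X =
  IsCircular X ×
  card X ≡ 20 ×
  (∀ w → X (revComp w) ≡ X w) ×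
  IsCircular (shiftSet X)

isXXY : Codon → Bool
isXXY (cod a b c) = eqB a b ∧ not (eqB b c)

shXXY : CodonSet → CodonSet
shXXY X w = X w ∧ isXXY w

-- S ∈ sh_XXY  (sets represented by characteristic functions, so equality is pointwise)
InShXXY : CodonSet → Set
InShXXY S = Σ CodonSet λ X → IsMaxC3Code X × (∀ w → S w ≡ shXXY X w)

-- The dihedral group D₄ as symmetries of the square with vertices A, C, T, G
-- (in cyclic order; A,T opposite and C,G opposite).
data D4 : Set where
  e    : D4
  ρ    : D4
  cc   : D4
  ρ³   : D4
  p    : D4
  r    : D4
  dAT  : D4
  dCG  : D4

actB : D4 → Base → Base
actB e   x = x
actB ρ   A = C
actB ρ   C = T
actB ρ   T = G
actB ρ   G = A
actB cc  x = comp x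
actB ρ³  A = G
actB ρ³  G = T
actB ρ³  T = C
actB ρ³  C = A
actB p   A = G
actB p   G = A
actB p   C = T
actB p   T = C
actB r   A = C
actB r   C = A
actB r   G = T
actB r   T = G
actB dAT A = A
actB dAT T = T
actB dAT C = G
actB dAT G = C
actB dCG C = C
actB dCG G = G
actB dCG A = T
actB dCG T = A

inv : D4 → D4
inv ρ  = ρ³
inv ρ³ = ρ
inv g  = g

actC : D4 → Codon → Codon
actC g (cod a b c) = cod (actB g a) (actB g b) (actB g c)

-- induced action on sets of codons: g·S = { g w | w ∈ S },
-- i.e. w ∈ g·S iff g⁻¹ w ∈ S
actSet : D4 → CodonSet → CodonSet
actSet g S w = S (actC (inv g) w)

-- Each codon class {w, α w, α² w} of a non-periodic codon contains exactly one word of a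
-- maximal C³ code X: at most one by circularity, and at least one because X has 20 words and
-- there are exactly 20 such classes. Together with self-complementarity and the circularity of
-- α(X), this shows that for every pair N ≠ M the code contains one of NNM, MMN, c(N)c(N)c(M),
-- c(M)c(M)c(N), but never both NNM and MMN. Every element of D₄ other than the identity, or its
-- square, swaps NNM with MMN and c(N)c(N)c(M) with c(M)c(M)c(N) for a suitable pair N ≠ M, so
-- it cannot fix sh(X, XXY).
module Submission where

open import Defs
open import Data.Bool using (true; false; _∧_)
open import Data.Bool.Properties using (_≟_; ∧-identityʳ)
open import Data.Empty using (⊥; ⊥-elim)
open import Data.Fin using (Fin; zero; suc)
import Data.Fin.Properties as Fin
open import Data.List using (List; []; _∷_; _++_; length; filter; map; concatMap)
open import Data.List.Membership.Propositional using (_∈_)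
open import Data.List.Membership.Propositional.Properties
  using (∈-map⁺; ∈-concat⁺′; ∈-++⁺ˡ; ∈-filter⁺)
open import Data.List.Properties using (length-++; filter-++; filter-none)
open import Data.List.Relation.Binary.Permutation.Propositional using (_↭_; ↭-sym; ↭-trans)
open import Data.List.Relation.Binary.Permutation.Propositional.Properties
  using (↭-length; filter-↭; map⁺)
open import Data.List.Relation.Unary.All using (All; []; _∷_)
open import Data.List.Relation.Unary.All.Properties using (¬Any⇒All¬)
open import Data.List.Relation.Unary.Any using (Any; here; there; any?)
open import Data.Nat using (ℕ; _+_; _≤_; _<_; z≤n; s≤s)
open import Data.Nat.ListAction using (sum)
open import Data.Nat.Properties using (+-mono-≤; +-mono-≤-<; +-identityʳ; <-irrefl)
open import Data.Product using (_×_; _,_)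
open import Data.Product.Relation.Binary.Lex.NonStrict using (×-decTotalOrder)
open import Data.Sum using (_⊎_; inj₁; inj₂)
open import Function using (_∘_)
open import Relation.Binary.Bundles using (DecTotalOrder)
open import Relation.Binary.PropositionalEquality
  using (_≡_; _≢_; refl; sym; trans; cong; cong₂; ≢-sym; module ≡-Reasoning)
open import Relation.Nullary using (¬_; yes; no; contradiction)
open import Relation.Unary using (Pred; Decidable)

comp-involutive : ∀ b → comp (comp b) ≡ b
comp-involutive A = refl
comp-involutive C = refl
comp-involutive G = refl
comp-involutive T = refl

comp-≢ : ∀ {n m} → n ≢ m → comp n ≢ comp m
comp-≢ {n} {m} n≢m eq =
  n≢m (trans (sym (comp-involutive n)) (trans (cong comp eq) (comp-involutive m)))

eqB-refl : ∀ b → eqB b b ≡ true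
eqB-refl A = refl
eqB-refl C = refl
eqB-refl G = refl
eqB-refl T = refl

eqB⇒≡ : ∀ {a b} → eqB a b ≡ true → a ≡ b
eqB⇒≡ {A} {A} refl = refl
eqB⇒≡ {C} {C} refl = refl
eqB⇒≡ {G} {G} refl = refl
eqB⇒≡ {T} {T} refl = refl

isXXY-nnm : ∀ {n m} → n ≢ m → isXXY (cod n n m) ≡ true
isXXY-nnm {n} {m} n≢m rewrite eqB-refl n with eqB n m in eq
... | true  = contradiction (eqB⇒≡ eq) n≢m
... | false = refl

module _ {X : CodonSet} (circular : IsCircular X) where

  -- The circular word abc also factors as the single word cab.
  no-shift-pair : ∀ {w} → w ∈ₛ X → shift w ∈ₛ X → ⊥
  no-shift-pair {cod a b c} w∈X shift-w∈X
    with circular (cod c a b) [] (cod a b c ∷ []) (c ∷ []) (a ∷ b ∷ [])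
                  shift-w∈X [] (w∈X ∷ []) (λ ()) refl refl
  ... | _ , () , _

  no-alternating-pair : ∀ {a b} → cod a b a ∈ₛ X → cod b a b ∈ₛ X → ⊥
  no-alternating-pair {a} {b} aba∈X bab∈X
    with circular (cod a b a) (cod b a b ∷ []) (cod b a b ∷ cod a b a ∷ []) (a ∷ []) (b ∷ a ∷ [])
                  aba∈X (bab∈X ∷ []) (bab∈X ∷ aba∈X ∷ []) (λ ()) refl refl
  ... | _ , () , _

  periodic-∉ : ∀ b → ¬ cod b b b ∈ₛ X
  periodic-∉ b bbb∈X = no-shift-pair bbb∈X bbb∈X

module _ {a p} {A : Set a} {P : Pred A p} (P? : Decidable P) where

  length-filter-++ : ∀ xs ys →
    length (filter P? (xs ++ ys)) ≡ length (filter P? xs) + length (filter P? ys)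
  length-filter-++ xs ys = trans (cong length (filter-++ P? xs ys)) (length-++ (filter P? xs))

  length-filter-concatMap : ∀ {b} {B : Set b} (f : B → List A) xs →
    length (filter P? (concatMap f xs)) ≡ sum (map (length ∘ filter P? ∘ f) xs)
  length-filter-concatMap f []       = refl
  length-filter-concatMap f (x ∷ xs) =
    trans (length-filter-++ (f x) (concatMap f xs)) (cong (_ +_) (length-filter-concatMap f xs))

module _ {a} {A : Set a} {f : A → ℕ} (f≤1 : ∀ x → f x ≤ 1) where

  sum-map≤length : ∀ xs → sum (map f xs) ≤ length xs
  sum-map≤length []       = z≤n
  sum-map≤length (x ∷ xs) = +-mono-≤ (f≤1 x) (sum-map≤length xs)

  sum-map<length : ∀ {x xs} → x ∈ xs → f x ≡ 0 → sum (map f xs) < length xs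
  sum-map<length {xs = _ ∷ xs} (here refl) fx≡0 rewrite fx≡0 = s≤s (sum-map≤length xs)
  sum-map<length {xs = y ∷ _}  (there x∈xs) fx≡0 = +-mono-≤-< (f≤1 y) (sum-map<length x∈xs fx≡0)

∈-allBases : ∀ b → b ∈ allBases
∈-allBases A = here refl
∈-allBases C = there (here refl)
∈-allBases G = there (there (here refl))
∈-allBases T = there (there (there (here refl)))

∈-allCodons : ∀ w → w ∈ allCodons
∈-allCodons (cod a b c) =
  ∈-concat⁺′ (∈-concat⁺′ (∈-map⁺ (cod a b) (∈-allBases c))
                         (∈-map⁺ (λ y → map (cod a y) allBases) (∈-allBases b)))
             (∈-map⁺ (λ x → concatMap (λ y → map (cod x y) allBases) allBases) (∈-allBases a))

count : CodonSet → List Codon → ℕ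
count X = length ∘ filter (λ w → X w ≟ true)

orbit : Codon → List Codon
orbit w = w ∷ shift w ∷ shift (shift w) ∷ []

xxyCodons : List Codon
xxyCodons = filter (λ w → isXXY w ≟ true) allCodons

-- A class with two distinct letters contains exactly one codon of shape XXY; the other eight
-- classes consist of codons with three distinct letters.
classReps : List Codon
classReps = xxyCodons ++
  cod A C G ∷ cod A G C ∷ cod A C T ∷ cod A T C ∷ cod A G T ∷ cod A T G ∷ cod C G T ∷ cod C T G ∷ []

periodicCodons : List Codon
periodicCodons = map (λ b → cod b b b) allBases

xxy∈classReps : ∀ {n m} → n ≢ m → cod n n m ∈ classReps
xxy∈classReps n≢m = ∈-++⁺ˡ (∈-filter⁺ (λ w → isXXY w ≟ true) (∈-allCodons _) (isXXY-nnm n≢m))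

index : Base → Fin 4
index A = zero
index C = suc zero
index G = suc (suc zero)
index T = suc (suc (suc zero))

base : Fin 4 → Base
base zero                   = A
base (suc zero)             = C
base (suc (suc zero))       = G
base (suc (suc (suc zero))) = T

encode : Codon → Fin 4 × Fin 4 × Fin 4
encode (cod a b c) = index a , index b , index c

decode : Fin 4 × Fin 4 × Fin 4 → Codon
decode (i , j , k) = cod (base i) (base j) (base k)

lexOrder : DecTotalOrder _ _ _
lexOrder = ×-decTotalOrder (Fin.≤-decTotalOrder 4)
                           (×-decTotalOrder (Fin.≤-decTotalOrder 4) (Fin.≤-decTotalOrder 4))

open import Data.List.Sort.InsertionSort.Base lexOrder using (sort)
open import Data.List.Sort.InsertionSort.Properties lexOrder using (sort-↭)

-- Both encoded lists sort to the same list (checked by evaluation); decoding the two sorting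
-- permutations gives the required one.
allCodons↭orbits : allCodons ↭ concatMap orbit classReps ++ periodicCodons
allCodons↭orbits = map⁺ decode {map encode allCodons} {map encode orbits}
  (↭-trans (↭-sym (sort-↭ (map encode allCodons))) (sort-↭ (map encode orbits)))
  where
  orbits : List Codon
  orbits = concatMap orbit classReps ++ periodicCodons

count-orbit≤1 : ∀ {X} → IsCircular X → ∀ w → count X (orbit w) ≤ 1
count-orbit≤1 {X} circular (cod a b c) with X (cod a b c) ≟ true
... | yes abc∈X with X (cod c a b) ≟ true
...   | yes cab∈X = ⊥-elim (no-shift-pair circular abc∈X cab∈X)
...   | no _ with X (cod b c a) ≟ true
...     | yes bca∈X = ⊥-elim (no-shift-pair circular bca∈X abc∈X)
...     | no _      = s≤s z≤n
count-orbit≤1 {X} circular (cod a b c) | no _ with X (cod c a b) ≟ true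
...   | yes cab∈X with X (cod b c a) ≟ true
...     | yes bca∈X = ⊥-elim (no-shift-pair circular cab∈X bca∈X)
...     | no _      = s≤s z≤n
count-orbit≤1 {X} circular (cod a b c) | no _ | no _ with X (cod b c a) ≟ true
...     | yes _ = s≤s z≤n
...     | no _  = z≤n

card≡sum-orbits : ∀ {X} → IsCircular X → card X ≡ sum (map (count X ∘ orbit) classReps)
card≡sum-orbits {X} circular = begin
  card X
    ≡⟨ ↭-length (filter-↭ X? allCodons↭orbits) ⟩
  count X (concatMap orbit classReps ++ periodicCodons)
    ≡⟨ length-filter-++ X? (concatMap orbit classReps) periodicCodons ⟩
  count X (concatMap orbit classReps) + count X periodicCodons
    ≡⟨ cong₂ _+_ (length-filter-concatMap X? orbit classReps)
                 (cong length (filter-none X? periodicCodons-∉)) ⟩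
  sum (map (count X ∘ orbit) classReps) + 0
    ≡⟨ +-identityʳ _ ⟩
  sum (map (count X ∘ orbit) classReps) ∎
  where
  open ≡-Reasoning
  X? : Decidable (_∈ₛ X)
  X? w = X w ≟ true
  periodicCodons-∉ : All (λ w → ¬ w ∈ₛ X) periodicCodons
  periodicCodons-∉ =
    periodic-∉ circular A ∷ periodic-∉ circular C ∷ periodic-∉ circular G ∷ periodic-∉ circular T ∷ []

orbit-meets : ∀ {X w} → IsMaxC3Code X → w ∈ classReps → Any (_∈ₛ X) (orbit w)
orbit-meets {X} {w} (circular , card≡20 , _) w∈reps with any? (λ v → X v ≟ true) (orbit w)
... | yes meets = meets
... | no ¬meets = ⊥-elim (<-irrefl card≡20 (begin-strict
  card X                                 ≡⟨ card≡sum-orbits circular ⟩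
  sum (map (count X ∘ orbit) classReps)  <⟨ sum-map<length (count-orbit≤1 circular) w∈reps orbit-empty ⟩
  20                                     ∎))
  where
  open Data.Nat.Properties.≤-Reasoning
  orbit-empty : count X (orbit w) ≡ 0
  orbit-empty = cong length (filter-none (λ v → X v ≟ true) (¬Any⇒All¬ (orbit w) ¬meets))

-- Reverse complements turn NNM, MMN into M'N'N', N'M'M', which α(X) reads as N'M'N', M'N'M'.
xxy-no-swap-pair : ∀ {X} → (∀ w → X (revComp w) ≡ X w) → IsCircular (shiftSet X) →
  ∀ {n m} → cod n n m ∈ₛ X → cod m m n ∈ₛ X → ⊥
xxy-no-swap-pair selfComp shiftCircular {n} {m} nnm∈X mmn∈X =
  no-alternating-pair shiftCircular {comp n} {comp m}
    (trans (selfComp (cod n n m)) nnm∈X) (trans (selfComp (cod m m n)) mmn∈X)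

-- The class of NNM meets X in NNM, in MNN (whose reverse complement is N'N'M') or in NMN; in the
-- last case MNM is excluded, so the class of MMN meets X in MMN or in NMM (reverse: M'M'N').
xxy-cover : ∀ {X} → IsMaxC3Code X → ∀ {n m} → n ≢ m →
  cod n n m ∈ₛ X ⊎ cod m m n ∈ₛ X ⊎
  cod (comp n) (comp n) (comp m) ∈ₛ X ⊎ cod (comp m) (comp m) (comp n) ∈ₛ X
xxy-cover code@(circular , _ , selfComp , _) {n} {m} n≢m
  with orbit-meets code (xxy∈classReps n≢m)
... | here nnm∈X         = inj₁ nnm∈X
... | there (here mnn∈X) = inj₂ (inj₂ (inj₁ (trans (selfComp (cod m n n)) mnn∈X)))
... | there (there (here nmn∈X)) with orbit-meets code (xxy∈classReps (≢-sym n≢m))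
...   | here mmn∈X                = inj₂ (inj₁ mmn∈X)
...   | there (here nmm∈X)        = inj₂ (inj₂ (inj₂ (trans (selfComp (cod n m m)) nmm∈X)))
...   | there (there (here mnm∈X)) = ⊥-elim (no-alternating-pair circular nmn∈X mnm∈X)

xxy-swap-pairs-differ : ∀ {X} → IsMaxC3Code X → ∀ {n m} → n ≢ m →
  X (cod n n m) ≡ X (cod m m n) →
  X (cod (comp n) (comp n) (comp m)) ≡ X (cod (comp m) (comp m) (comp n)) → ⊥
xxy-swap-pairs-differ code@(_ , _ , selfComp , shiftCircular) n≢m eq eq′ with xxy-cover code n≢m
... | inj₁ h               = xxy-no-swap-pair selfComp shiftCircular h (trans (sym eq) h)
... | inj₂ (inj₁ h)        = xxy-no-swap-pair selfComp shiftCircular (trans eq h) h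
... | inj₂ (inj₂ (inj₁ h)) = xxy-no-swap-pair selfComp shiftCircular h (trans (sym eq′) h)
... | inj₂ (inj₂ (inj₂ h)) = xxy-no-swap-pair selfComp shiftCircular (trans eq′ h) h

Invariant : (Codon → Codon) → CodonSet → Set
Invariant φ S = ∀ w → S (φ w) ≡ S w

Invariant-∘ : ∀ {φ ψ S} → Invariant φ S → Invariant ψ S → Invariant (φ ∘ ψ) S
Invariant-∘ {ψ = ψ} φ-inv ψ-inv w = trans (φ-inv (ψ w)) (ψ-inv w)

shXXY-xxy : ∀ X {w} → isXXY w ≡ true → shXXY X w ≡ X w
shXXY-xxy X {w} w-xxy = trans (cong (X w ∧_) w-xxy) (∧-identityʳ (X w))

no-invariant-swap : ∀ {X S φ} → IsMaxC3Code X → (∀ w → S w ≡ shXXY X w) → Invariant φ S →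
  ∀ {n m} → n ≢ m →
  φ (cod n n m) ≡ cod m m n →
  φ (cod (comp n) (comp n) (comp m)) ≡ cod (comp m) (comp m) (comp n) → ⊥
no-invariant-swap {X} {S} {φ} code S≡ φ-inv n≢m swap swap′ =
  xxy-swap-pairs-differ code n≢m (agree n≢m swap) (agree (comp-≢ n≢m) swap′)
  where
  agree : ∀ {k l} → k ≢ l → φ (cod k k l) ≡ cod l l k → X (cod k k l) ≡ X (cod l l k)
  agree {k} {l} k≢l φ-kkl = begin
    X (cod k k l)          ≡⟨ sym (shXXY-xxy X (isXXY-nnm k≢l)) ⟩
    shXXY X (cod k k l)    ≡⟨ sym (S≡ _) ⟩
    S (cod k k l)          ≡⟨ sym (φ-inv _) ⟩
    S (φ (cod k k l))      ≡⟨ cong S φ-kkl ⟩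
    S (cod l l k)          ≡⟨ S≡ _ ⟩
    shXXY X (cod l l k)    ≡⟨ shXXY-xxy X (isXXY-nnm (≢-sym k≢l)) ⟩
    X (cod l l k)          ∎
    where open ≡-Reasoning

mainTheorem7 : (S : CodonSet) → InShXXY S →
    (g : D4) → (∀ w → actSet g S w ≡ S w) → g ≡ e
mainTheorem7 _ _               e   _   = refl
mainTheorem7 S (_ , code , S≡) cc  fix = ⊥-elim (no-invariant-swap code S≡ fix {A} {T} (λ ()) refl refl)
mainTheorem7 S (_ , code , S≡) dCG fix = ⊥-elim (no-invariant-swap code S≡ fix {A} {T} (λ ()) refl refl)
mainTheorem7 S (_ , code , S≡) dAT fix = ⊥-elim (no-invariant-swap code S≡ fix {C} {G} (λ ()) refl refl)
mainTheorem7 S (_ , code , S≡) p   fix = ⊥-elim (no-invariant-swap code S≡ fix {A} {G} (λ ()) refl refl)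
mainTheorem7 S (_ , code , S≡) r   fix = ⊥-elim (no-invariant-swap code S≡ fix {A} {C} (λ ()) refl refl)
mainTheorem7 S (_ , code , S≡) ρ   fix =
  ⊥-elim (no-invariant-swap code S≡ (Invariant-∘ fix fix) {A} {T} (λ ()) refl refl)
mainTheorem7 S (_ , code , S≡) ρ³  fix =
  ⊥-elim (no-invariant-swap code S≡ (Invariant-∘ fix fix) {A} {T} (λ ()) refl refl)
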